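{- For every integer $n\ge 5$, the LZ-factorization of $F_n$ is $(\mathtt{a},\mathtt{b},\mathtt{a},F_4^R,F_5^R,\dots,F_{n-2}^R,s)$, where $s=\mathtt{ab}$ if $n$ is odd and $s=\mathtt{ba}$ if $n$ is even. In particular it has $n-1$ phrases.
   Context: Fibonacci words: $F_1=\mathtt{b}$, $F_2=\mathtt{a}$, $F_i=F_{i-1}F_{i-2}$ for $i\ge 3$. For a string $x$, $x^R$ is its reversal. A factorization of $w$ is a sequence $(s_1,\dots,s_m)$ of non-empty strings with $w=s_1\cdots s_m$; phrase $s_i$ is greedy if either it is a single symbol occurring for the first time in $s_1\cdots s_i$, or it is the longest prefix of $s_i\cdots s_m$ occurring as a substring of $s_1\cdots s_{i-1}$. The LZ-factorization is the factorization in which all phrases are greedy. (For $n=5$ the list $F_4^R,\dots,F_{n-2}^R$ is empty.) -}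

module Defs where

open import Data.Nat using (ℕ; zero; suc; _∸_; _+_)
open import Data.List using (List; []; _∷_; _++_; [_]; concat; reverse; map; upTo; length)
open import Data.List.Membership.Propositional using (_∈_)
open import Data.List.Relation.Unary.All using (All)
open import Data.Product using (_×_; ∃-syntax)
open import Data.Sum using (_⊎_)
open import Data.Unit using (⊤)
open import Data.Nat using (_>_)
open import Relation.Binary.PropositionalEquality using (_≡_; _≢_)
open import Relation.Nullary using (¬_)

data Sym : Set where
  a b : Sym

Str : Set
Str = List Sym

-- Fibonacci words: F 1 = b, F 2 = a, F i = F (i-1) F (i-2) for i ≥ 3
-- (F 0 is an unused dummy value)
F : ℕ → Str
F zero = []
F (suc zero) = b ∷ []
F (suc (suc zero)) = a ∷ []
F (suc (suc (suc i))) = F (suc (suc i)) ++ F (suc i)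

IsSubstring : Str → Str → Set
IsSubstring t p = ∃[ u ] ∃[ v ] p ≡ u ++ t ++ v

IsPrefix : Str → Str → Set
IsPrefix t r = ∃[ v ] r ≡ t ++ v

-- phrase s is greedy, where p = s_1 ⋯ s_{i-1} and r = s_i ⋯ s_m
Greedy : Str → Str → Str → Set
Greedy p s r =
  (∃[ c ] (s ≡ c ∷ [] × ¬ (c ∈ p)))
  ⊎ (IsPrefix s r × IsSubstring s p
      × (∀ t → IsPrefix t r → length t > length s → ¬ IsSubstring t p))

AllGreedyFrom : Str → List Str → Set
AllGreedyFrom p [] = ⊤
AllGreedyFrom p (s ∷ ss) = Greedy p s (concat (s ∷ ss)) × AllGreedyFrom (p ++ s) ss

NonEmpty : Str → Set
NonEmpty s = s ≢ []

IsFactorization : Str → List Str → Set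
IsFactorization w fs = All NonEmpty fs × concat fs ≡ w

IsLZ : Str → List Str → Set
IsLZ w fs = IsFactorization w fs × AllGreedyFrom [] fs

lastPhrase : ℕ → Str
lastPhrase zero = b ∷ a ∷ []
lastPhrase (suc zero) = a ∷ b ∷ []
lastPhrase (suc (suc n)) = lastPhrase n

lzFib : ℕ → List Str
lzFib n = (a ∷ []) ∷ (b ∷ []) ∷ (a ∷ [])
  ∷ (map (λ k → reverse (F (4 + k))) (upTo (n ∸ 5)) ++ [ lastPhrase n ])

{-# OPTIONS --safe #-}
module Submission where

-- Write F n = C n · s n with s n = lastPhrase n ∈ {ab, ba}. The words C n are
-- palindromes with C (n+2) = C (n+1) s (n+1) C n = C n s n C (n+1), hence
-- F (n+1)^R = s (n+2) C (n+1) and C (n+2) = C n F (n+1)^R = F (n+1) C n.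
-- After the prefix aba = C 5 the phrase F k^R therefore always occurs, as a
-- suffix, in the text C (k+1) read so far, and reading it leads to C (k+2).
-- It is the longest such phrase: a longer one F k^R x ⋯ occurring in the
-- palindrome C (k+1) = F k C (k-1) would yield an occurrence of x F k inside
-- F k C (k-1), i.e. a period of F k shorter than |F (k-1)|, whereas the least
-- period of a Fibonacci word F k is |F (k-1)|. Finally, greedy factorizations
-- are determined phrase by phrase, which gives uniqueness.

open import Defs
open import Data.Nat using (ℕ; zero; suc; _≤_; _<_; _>_; _∸_; _+_; z≤n; s≤s)
open import Data.Nat.Properties
open import Data.Nat.Tactic.RingSolver using (solve-∀)
open import Data.List using (List; []; _∷_; _++_; [_]; length; reverse; map; concat; upTo; applyUpTo)
open import Data.List.Properties using (++-assoc; ++-identityʳ; ++-cancelˡ; reverse-++; reverse-involutive; unfold-reverse; length-++; length-++-≤ˡ; length-map; length-upTo; map-upTo; concat-++; ++-conicalˡ; ∷-injectiveˡ; ∷-injectiveʳ)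
open import Data.List.Relation.Unary.All using (All; []; _∷_)
open import Data.List.Relation.Unary.All.Properties using (++⁺)
open import Data.List.Relation.Unary.Any using (here; there)
open import Data.List.Membership.Propositional using (_∈_)
open import Data.List.Membership.Propositional.Properties using (∈-insert)
open import Data.Maybe using (Maybe; just; nothing)
open import Data.Product using (_×_; _,_; ∃-syntax)
open import Data.Sum using (inj₁; inj₂)
open import Data.Unit using (tt)
open import Data.Empty using (⊥-elim)
open import Relation.Binary.PropositionalEquality hiding ([_])
open import Relation.Binary.Definitions using (tri<; tri≈; tri>)
open import Relation.Nullary using (¬_)

applyUpTo-cong : ∀ {A : Set} {f g : ℕ → A} → (∀ i → f i ≡ g i) → ∀ n → applyUpTo f n ≡ applyUpTo g n
applyUpTo-cong f≗g zero = refl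
applyUpTo-cong f≗g (suc n) = cong₂ _∷_ (f≗g 0) (applyUpTo-cong (λ i → f≗g (suc i)) n)

nonEmpty-++ˡ : ∀ {u} v → NonEmpty u → NonEmpty (u ++ v)
nonEmpty-++ˡ {[]} v ne = ⊥-elim (ne refl)
nonEmpty-++ˡ {x ∷ u} v ne ()

nonEmpty-++ʳ : ∀ u {v} → NonEmpty v → NonEmpty (u ++ v)
nonEmpty-++ʳ [] ne = ne
nonEmpty-++ʳ (x ∷ u) ne ()

nonEmpty-reverse : ∀ {w} → NonEmpty w → NonEmpty (reverse w)
nonEmpty-reverse {w} ne e = ne (trans (sym (reverse-involutive w)) (cong reverse e))

nonEmpty-concat-∷ʳ : ∀ ws {w} → NonEmpty w → NonEmpty (concat (ws ++ [ w ]))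
nonEmpty-concat-∷ʳ ws ne = subst NonEmpty (concat-++ ws _) (nonEmpty-++ʳ (concat ws) (nonEmpty-++ˡ [] ne))

nonEmpty⇒length>0 : ∀ {w} → NonEmpty w → 0 < length w
nonEmpty⇒length>0 {[]} ne = ⊥-elim (ne refl)
nonEmpty⇒length>0 {x ∷ w} ne = s≤s z≤n

isPrefix⇒length≤ : ∀ {t r} → IsPrefix t r → length t ≤ length r
isPrefix⇒length≤ {t} (v , refl) = length-++-≤ˡ t

isPrefix-longer : ∀ s {t} x y → IsPrefix t (s ++ x ∷ y) → length s < length t → ∃[ z ] t ≡ s ++ x ∷ z
isPrefix-longer [] {[]} x y _ ()
isPrefix-longer [] {c ∷ t} x y (v , e) _ = t , cong (_∷ t) (sym (∷-injectiveˡ e))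
isPrefix-longer (c ∷ s) {[]} x y _ ()
isPrefix-longer (c ∷ s) {c′ ∷ t} x y (v , e) (s≤s lt) with isPrefix-longer s x y (v , ∷-injectiveʳ e) lt
... | z , t≡ = z , cong₂ _∷_ (sym (∷-injectiveˡ e)) t≡

isPrefix-unique : ∀ (s₁ s₂ v₁ v₂ : Str) → s₁ ++ v₁ ≡ s₂ ++ v₂ → length s₁ ≡ length s₂ → s₁ ≡ s₂
isPrefix-unique [] [] v₁ v₂ e l = refl
isPrefix-unique [] (x ∷ s₂) v₁ v₂ e ()
isPrefix-unique (x ∷ s₁) [] v₁ v₂ e ()
isPrefix-unique (x ∷ s₁) (y ∷ s₂) v₁ v₂ e l =
  cong₂ _∷_ (∷-injectiveˡ e) (isPrefix-unique s₁ s₂ v₁ v₂ (∷-injectiveʳ e) (suc-injective l))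

isSubstring-prefix : ∀ {p} t v → IsSubstring (t ++ v) p → IsSubstring t p
isSubstring-prefix t v (u , w , e) = u , v ++ w , trans e (cong (u ++_) (++-assoc t v w))

isSubstring-suffix : ∀ {p} u t → IsSubstring (u ++ t) p → IsSubstring t p
isSubstring-suffix u t (u′ , w , e) =
  u′ ++ u , w , trans e (trans (cong (u′ ++_) (++-assoc u t w)) (sym (++-assoc u′ u (t ++ w))))

isSubstring-reverse : ∀ {t p} → IsSubstring t p → IsSubstring (reverse t) (reverse p)
isSubstring-reverse {t} (u , w , refl) = reverse w , reverse u , (begin
    reverse (u ++ t ++ w)                 ≡⟨ reverse-++ u (t ++ w) ⟩
    reverse (t ++ w) ++ reverse u         ≡⟨ cong (_++ reverse u) (reverse-++ t w) ⟩
    (reverse w ++ reverse t) ++ reverse u ≡⟨ ++-assoc (reverse w) (reverse t) (reverse u) ⟩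
    reverse w ++ reverse t ++ reverse u   ∎)
  where open ≡-Reasoning

at : Str → ℕ → Maybe Sym
at [] _ = nothing
at (x ∷ _) zero = just x
at (_ ∷ w) (suc i) = at w i

at-++ˡ : ∀ u {v i} → i < length u → at (u ++ v) i ≡ at u i
at-++ˡ (x ∷ u) {i = zero} _ = refl
at-++ˡ (x ∷ u) {i = suc i} (s≤s lt) = at-++ˡ u lt

at-++ʳ : ∀ u {v} i → at (u ++ v) (length u + i) ≡ at v i
at-++ʳ [] i = refl
at-++ʳ (x ∷ u) i = at-++ʳ u i

HasPeriod : ℕ → Str → Set
HasPeriod d w = ∀ i → i + d < length w → at w i ≡ at w (i + d)

hasPeriod-++ˡ : ∀ {d} u v → HasPeriod d (u ++ v) → HasPeriod d u
hasPeriod-++ˡ {d} u v per i lt = begin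
    at u i              ≡⟨ sym (at-++ˡ u (≤-<-trans (m≤m+n i d) lt)) ⟩
    at (u ++ v) i       ≡⟨ per i (<-≤-trans lt (length-++-≤ˡ u)) ⟩
    at (u ++ v) (i + d) ≡⟨ at-++ˡ u lt ⟩
    at u (i + d)        ∎
  where open ≡-Reasoning

isPrefix⇒hasPeriod : ∀ u v → IsPrefix v u → HasPeriod (length u) (u ++ v)
isPrefix⇒hasPeriod u v (y , refl) i lt = begin
    at (u ++ v) i              ≡⟨ at-++ˡ u (<-≤-trans i<v (length-++-≤ˡ v)) ⟩
    at (v ++ y) i              ≡⟨ at-++ˡ v i<v ⟩
    at v i                     ≡⟨ sym (at-++ʳ u i) ⟩
    at (u ++ v) (length u + i) ≡⟨ cong (at (u ++ v)) (+-comm (length u) i) ⟩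
    at (u ++ v) (i + length u) ∎
  where
  open ≡-Reasoning
  i<v : i < length v
  i<v = +-cancelʳ-< (length u) i (length v) (subst (i + length u <_) (trans (length-++ u) (+-comm (length u) _)) lt)

hasPeriod-difference : ∀ {d q} u v → d ≤ length v →
  HasPeriod d (u ++ v) → HasPeriod (q + d) (u ++ v) → HasPeriod q u
hasPeriod-difference {d} {q} u v d≤v per-d per-qd i lt = begin
    at u i                   ≡⟨ sym (at-++ˡ u (≤-<-trans (m≤m+n i q) lt)) ⟩
    at (u ++ v) i            ≡⟨ per-qd i (subst (_< length (u ++ v)) (+-assoc i q d) bound) ⟩
    at (u ++ v) (i + (q + d)) ≡⟨ cong (at (u ++ v)) (sym (+-assoc i q d)) ⟩
    at (u ++ v) (i + q + d)   ≡⟨ sym (per-d (i + q) bound) ⟩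
    at (u ++ v) (i + q)       ≡⟨ at-++ˡ u lt ⟩
    at u (i + q)              ∎
  where
  open ≡-Reasoning
  bound : i + q + d < length (u ++ v)
  bound = subst (i + q + d <_) (sym (length-++ u)) (+-mono-<-≤ lt d≤v)

occurrence⇒hasPeriod : ∀ (P y u : Str) {c v} → P ++ y ≡ u ++ c ∷ (P ++ v) → HasPeriod (suc (length u)) P
occurrence⇒hasPeriod P y u {c} {v} e i lt = begin
    at P i                                      ≡⟨ sym (at-++ˡ P (≤-<-trans (m≤m+n i _) lt)) ⟩
    at (P ++ v) i                               ≡⟨ sym (at-++ʳ u (suc i)) ⟩
    at (u ++ c ∷ (P ++ v)) (length u + suc i)   ≡⟨ cong (at (u ++ c ∷ (P ++ v))) (shift (length u) i) ⟩
    at (u ++ c ∷ (P ++ v)) (i + suc (length u)) ≡⟨ cong (λ w → at w (i + suc (length u))) (sym e) ⟩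
    at (P ++ y) (i + suc (length u))            ≡⟨ at-++ˡ P lt ⟩
    at P (i + suc (length u))                   ∎
  where
  open ≡-Reasoning
  shift : ∀ k i → k + suc i ≡ i + suc k
  shift = solve-∀

occurrence-shift< : ∀ (P y u : Str) {c v} → P ++ y ≡ u ++ c ∷ (P ++ v) → length u < length y
occurrence-shift< P y u {c} {v} e = +-cancelˡ-≤ (length P) _ _ (begin
    length P + suc (length u)                ≤⟨ m≤m+n _ (length v) ⟩
    length P + suc (length u) + length v     ≡⟨ rearrange (length P) (length u) (length v) ⟩
    length u + suc (length P + length v)     ≡⟨ sym lengths ⟩
    length P + length y                      ∎)
  where
  open ≤-Reasoning
  rearrange : ∀ p u v → p + suc u + v ≡ u + suc (p + v)
  rearrange = solve-∀
  lengths : length P + length y ≡ length u + suc (length P + length v)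
  lengths = trans (sym (length-++ P)) (trans (cong length e) (trans (length-++ u) (cong (λ l → length u + suc l) (length-++ P))))

noShortPeriod-step : ∀ Y Z → length Z < length Y →
  (∀ {d} → 0 < d → d < length Y → ¬ HasPeriod d (Y ++ Z)) →
  (∀ {d} → 0 < d → d < length Z → ¬ HasPeriod d Y) →
  ∀ {d} → 0 < d → d < length (Y ++ Z) → ¬ HasPeriod d ((Y ++ Z) ++ Y)
-- For d ≥ |Y| use the second period |YZ| of (YZ)Y, which holds as Y is a prefix of YZ.
noShortPeriod-step Y Z Z<Y noPerYZ noPerY {d} 0<d d<YZ per with <-cmp d (length Y)
... | tri< d<Y _ _ = noPerYZ 0<d d<Y (hasPeriod-++ˡ (Y ++ Z) Y per)
... | tri≈ _ refl _ = noPerYZ 0<Z Z<Y (hasPeriod-difference (Y ++ Z) Y ≤-refl per per-YZ)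
  where
  per-YZ : HasPeriod (length Z + length Y) ((Y ++ Z) ++ Y)
  per-YZ = subst (λ p → HasPeriod p ((Y ++ Z) ++ Y)) (trans (length-++ Y) (+-comm (length Y) _)) (isPrefix⇒hasPeriod (Y ++ Z) Y (Z , refl))
  0<Z : 0 < length Z
  0<Z = +-cancelˡ-< (length Y) 0 (length Z) (subst₂ _<_ (sym (+-identityʳ _)) (length-++ Y) d<YZ)
... | tri> _ _ Y<d = noPerY (m<n⇒0<n∸m d<YZ) q<Z (hasPeriod-difference Y (Z ++ Y) d≤ZY per′ per-YZ)
  where
  q : ℕ
  q = length (Y ++ Z) ∸ d
  lenYZ : length (Y ++ Z) ≡ length Z + length Y
  lenYZ = trans (length-++ Y) (+-comm (length Y) _)
  q<Z : q < length Z
  q<Z = <-≤-trans (∸-monoʳ-< Y<d (<⇒≤ d<YZ)) (≤-reflexive (trans (cong (_∸ length Y) lenYZ) (m+n∸n≡m (length Z) (length Y))))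
  d≤ZY : d ≤ length (Z ++ Y)
  d≤ZY = <⇒≤ (subst (d <_) (trans lenYZ (sym (length-++ Z))) d<YZ)
  per′ : HasPeriod d (Y ++ Z ++ Y)
  per′ = subst (HasPeriod d) (++-assoc Y Z Y) per
  per-YZ : HasPeriod (q + d) (Y ++ Z ++ Y)
  per-YZ = subst₂ HasPeriod (sym (m∸n+n≡m (<⇒≤ d<YZ))) (++-assoc Y Z Y) (isPrefix⇒hasPeriod (Y ++ Z) Y (Z , refl))

F-nonEmpty : ∀ m → NonEmpty (F (suc m))
F-nonEmpty zero = λ ()
F-nonEmpty (suc zero) = λ ()
F-nonEmpty (suc (suc m)) = nonEmpty-++ˡ (F (suc m)) (F-nonEmpty (suc m))

F-noShortPeriod : ∀ m {d} → 0 < d → d < length (F (suc m)) → ¬ HasPeriod d (F (2 + m))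
F-noShortPeriod zero {suc d} _ (s≤s ())
F-noShortPeriod (suc zero) {suc d} _ (s≤s ())
F-noShortPeriod (suc (suc zero)) {suc zero} _ _ per with per 0 (s≤s (s≤s z≤n))
... | ()
F-noShortPeriod (suc (suc zero)) {suc (suc d)} _ (s≤s (s≤s ()))
F-noShortPeriod (suc (suc (suc m))) =
  noShortPeriod-step (F (3 + m)) (F (2 + m)) F₂<F₃ (F-noShortPeriod (suc (suc m))) (F-noShortPeriod (suc m))
  where
  F₂<F₃ : length (F (2 + m)) < length (F (3 + m))
  F₂<F₃ = subst (length (F (2 + m)) <_) (sym (length-++ (F (2 + m)))) (m<m+n _ (nonEmpty⇒length>0 (F-nonEmpty m)))

lastPhrase-nonEmpty : ∀ n → NonEmpty (lastPhrase n)
lastPhrase-nonEmpty zero = λ ()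
lastPhrase-nonEmpty (suc zero) = λ ()
lastPhrase-nonEmpty (suc (suc n)) = lastPhrase-nonEmpty n

reverse-lastPhrase : ∀ n → reverse (lastPhrase n) ≡ lastPhrase (suc n)
reverse-lastPhrase zero = refl
reverse-lastPhrase (suc zero) = refl
reverse-lastPhrase (suc (suc n)) = reverse-lastPhrase n

-- F n with its last two symbols removed (n ≥ 3); junk value [] below 3.
central : ℕ → Str
central (suc (suc (suc zero))) = []
central (suc (suc (suc (suc zero)))) = a ∷ []
central (suc (suc (suc (suc (suc n))))) =
  central (suc (suc (suc (suc n)))) ++ lastPhrase (4 + n) ++ central (suc (suc (suc n)))
central _ = []

F-central : ∀ m → F (3 + m) ≡ central (3 + m) ++ lastPhrase (3 + m)
F-central zero = refl
F-central (suc zero) = refl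
F-central (suc (suc m)) = begin
    F (4 + m) ++ F (3 + m)   ≡⟨ cong₂ _++_ (F-central (suc m)) (F-central m) ⟩
    (C₄ ++ s₄) ++ (C₃ ++ s₃) ≡⟨ ++-assoc C₄ s₄ (C₃ ++ s₃) ⟩
    C₄ ++ s₄ ++ C₃ ++ s₃     ≡⟨ cong (C₄ ++_) (sym (++-assoc s₄ C₃ s₃)) ⟩
    C₄ ++ (s₄ ++ C₃) ++ s₃   ≡⟨ sym (++-assoc C₄ (s₄ ++ C₃) s₃) ⟩
    (C₄ ++ s₄ ++ C₃) ++ s₃   ∎
  where
  open ≡-Reasoning
  C₃ C₄ s₃ s₄ : Str
  C₃ = central (3 + m)
  C₄ = central (4 + m)
  s₃ = lastPhrase (3 + m)
  s₄ = lastPhrase (4 + m)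

central-swap : ∀ m → central (3 + m) ++ lastPhrase (3 + m) ++ central (4 + m) ≡ central (5 + m)
central-swap zero = refl
central-swap (suc m) = begin
    C₄ ++ s₄ ++ central (5 + m)  ≡⟨ cong (λ w → C₄ ++ s₄ ++ w) (sym (central-swap m)) ⟩
    C₄ ++ s₄ ++ (C₃ ++ s₃ ++ C₄) ≡⟨ cong (C₄ ++_) (sym (++-assoc s₄ C₃ (s₃ ++ C₄))) ⟩
    C₄ ++ (s₄ ++ C₃) ++ s₃ ++ C₄ ≡⟨ sym (++-assoc C₄ (s₄ ++ C₃) (s₃ ++ C₄)) ⟩
    (C₄ ++ s₄ ++ C₃) ++ s₃ ++ C₄ ∎
  where
  open ≡-Reasoning
  C₃ C₄ s₃ s₄ : Str
  C₃ = central (3 + m)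
  C₄ = central (4 + m)
  s₃ = lastPhrase (3 + m)
  s₄ = lastPhrase (4 + m)

central-palindrome : ∀ m → reverse (central (3 + m)) ≡ central (3 + m)
central-palindrome zero = refl
central-palindrome (suc zero) = refl
central-palindrome (suc (suc m)) = begin
    reverse (C₄ ++ s₄ ++ C₃)                      ≡⟨ reverse-++ C₄ (s₄ ++ C₃) ⟩
    reverse (s₄ ++ C₃) ++ reverse C₄              ≡⟨ cong (_++ reverse C₄) (reverse-++ s₄ C₃) ⟩
    (reverse C₃ ++ reverse s₄) ++ reverse C₄      ≡⟨ cong₂ (λ u w → (u ++ reverse s₄) ++ w) (central-palindrome m) (central-palindrome (suc m)) ⟩
    (C₃ ++ reverse s₄) ++ C₄                      ≡⟨ cong (λ w → (C₃ ++ w) ++ C₄) (reverse-lastPhrase (4 + m)) ⟩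
    (C₃ ++ lastPhrase (3 + m)) ++ C₄              ≡⟨ ++-assoc C₃ _ C₄ ⟩
    C₃ ++ lastPhrase (3 + m) ++ C₄                ≡⟨ central-swap m ⟩
    central (5 + m)                               ∎
  where
  open ≡-Reasoning
  C₃ C₄ s₄ : Str
  C₃ = central (3 + m)
  C₄ = central (4 + m)
  s₄ = lastPhrase (4 + m)

reverse-F : ∀ m → reverse (F (3 + m)) ≡ lastPhrase (4 + m) ++ central (3 + m)
reverse-F m = begin
    reverse (F (3 + m))                                          ≡⟨ cong reverse (F-central m) ⟩
    reverse (central (3 + m) ++ lastPhrase (3 + m))              ≡⟨ reverse-++ (central (3 + m)) _ ⟩
    reverse (lastPhrase (3 + m)) ++ reverse (central (3 + m))    ≡⟨ cong₂ _++_ (reverse-lastPhrase (3 + m)) (central-palindrome m) ⟩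
    lastPhrase (4 + m) ++ central (3 + m)                        ∎
  where open ≡-Reasoning

central-F-prefix : ∀ m → central (5 + m) ≡ F (4 + m) ++ central (3 + m)
central-F-prefix m =
  trans (sym (++-assoc (central (4 + m)) (lastPhrase (4 + m)) (central (3 + m))))
        (cong (_++ central (3 + m)) (sym (F-central (suc m))))

central-reverse-F-suffix : ∀ m → central (5 + m) ≡ central (3 + m) ++ reverse (F (4 + m))
central-reverse-F-suffix m = trans (sym (central-swap m)) (cong (central (3 + m) ++_) (sym (reverse-F (suc m))))

central-extend : ∀ m → central (5 + m) ++ reverse (F (4 + m)) ≡ central (6 + m)
central-extend m = cong (central (5 + m) ++_) (reverse-F (suc m))

lastPhrase-in-central : ∀ m → IsSubstring (lastPhrase (5 + m)) (central (5 + m))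
lastPhrase-in-central zero = [] , a ∷ [] , refl
lastPhrase-in-central (suc zero) = a ∷ [] , a ∷ b ∷ a ∷ [] , refl
lastPhrase-in-central (suc (suc m)) =
  central (5 + m) , central (4 + m) ++ lastPhrase (6 + m) ++ central (5 + m) ,
  trans (++-assoc (central (5 + m)) _ _) (cong (central (5 + m) ++_) (++-assoc (lastPhrase (5 + m)) (central (4 + m)) _))

central-noInnerF : ∀ m x → ¬ IsSubstring (x ∷ F (4 + m)) (central (5 + m))
central-noInnerF m x (u , v , e) =
  F-noShortPeriod (2 + m) (s≤s z≤n) shift<F₃ (occurrence⇒hasPeriod (F (4 + m)) (central (3 + m)) u occurrence)
  where
  occurrence : F (4 + m) ++ central (3 + m) ≡ u ++ x ∷ (F (4 + m) ++ v)
  occurrence = trans (sym (central-F-prefix m)) e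
  shift<F₃ : suc (length u) < length (F (3 + m))
  shift<F₃ = begin-strict
    suc (length u)                                         ≤⟨ occurrence-shift< (F (4 + m)) (central (3 + m)) u occurrence ⟩
    length (central (3 + m))                               <⟨ m<m+n _ (nonEmpty⇒length>0 (lastPhrase-nonEmpty (3 + m))) ⟩
    length (central (3 + m)) + length (lastPhrase (3 + m)) ≡⟨ sym (length-++ (central (3 + m))) ⟩
    length (central (3 + m) ++ lastPhrase (3 + m))         ≡⟨ cong length (sym (F-central m)) ⟩
    length (F (3 + m))                                     ∎
    where open ≤-Reasoning

greedy-whole : ∀ {p s} → IsSubstring s p → Greedy p s (s ++ [])
greedy-whole {s = s} occ = inj₂ (([] , refl) , occ , λ t pre longer _ →
  <⇒≱ longer (subst (length t ≤_) (cong length (++-identityʳ s)) (isPrefix⇒length≤ pre)))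

reverse-F-greedy : ∀ m {r} → NonEmpty r →
  Greedy (central (5 + m)) (reverse (F (4 + m))) (reverse (F (4 + m)) ++ r)
reverse-F-greedy m {[]} ne = ⊥-elim (ne refl)
reverse-F-greedy m {x ∷ z} _ = inj₂ ((x ∷ z , refl) , suffix , longest)
  where
  R : Str
  R = reverse (F (4 + m))
  suffix : IsSubstring R (central (5 + m))
  suffix = central (3 + m) , [] , trans (central-reverse-F-suffix m) (cong (central (3 + m) ++_) (sym (++-identityʳ R)))
  longest : ∀ t → IsPrefix t (R ++ x ∷ z) → length t > length R → ¬ IsSubstring t (central (5 + m))
  longest t pre longer occ with isPrefix-longer R x z pre longer
  ... | z′ , refl = central-noInnerF m x (isSubstring-suffix (reverse z′) (x ∷ F (4 + m))
                      (subst₂ IsSubstring reversed (central-palindrome (2 + m)) (isSubstring-reverse occ)))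
    where
    reversed : reverse (R ++ x ∷ z′) ≡ reverse z′ ++ x ∷ F (4 + m)
    reversed = begin
      reverse (R ++ x ∷ z′)              ≡⟨ reverse-++ R (x ∷ z′) ⟩
      reverse (x ∷ z′) ++ reverse R      ≡⟨ cong₂ _++_ (unfold-reverse x z′) (reverse-involutive (F (4 + m))) ⟩
      (reverse z′ ++ [ x ]) ++ F (4 + m) ≡⟨ ++-assoc (reverse z′) [ x ] (F (4 + m)) ⟩
      reverse z′ ++ x ∷ F (4 + m)        ∎
      where open ≡-Reasoning

reversedFs : ℕ → ℕ → List Str
reversedFs k zero = []
reversedFs k (suc j) = reverse (F k) ∷ reversedFs (suc k) j

applyUpTo-reversedFs : ∀ k j → applyUpTo (λ i → reverse (F (k + i))) j ≡ reversedFs k j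
applyUpTo-reversedFs k zero = refl
applyUpTo-reversedFs k (suc j) = cong₂ _∷_ (cong (λ i → reverse (F i)) (+-identityʳ k))
  (trans (applyUpTo-cong (λ i → cong (λ l → reverse (F l)) (+-suc k i)) j) (applyUpTo-reversedFs (suc k) j))

reversedFs-nonEmpty : ∀ m j → All NonEmpty (reversedFs (suc m) j)
reversedFs-nonEmpty m zero = []
reversedFs-nonEmpty m (suc j) = nonEmpty-reverse (F-nonEmpty m) ∷ reversedFs-nonEmpty (suc m) j

concat-tail : ∀ m j {n} → n ≡ j + (5 + m) →
  central (5 + m) ++ concat (reversedFs (4 + m) j ++ [ lastPhrase n ]) ≡ F n
concat-tail m zero refl = trans (cong (central (5 + m) ++_) (++-identityʳ _)) (sym (F-central (2 + m)))
concat-tail m (suc j) {n} eq = begin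
    central (5 + m) ++ reverse (F (4 + m)) ++ concat rest   ≡⟨ sym (++-assoc (central (5 + m)) _ _) ⟩
    (central (5 + m) ++ reverse (F (4 + m))) ++ concat rest ≡⟨ cong (_++ concat rest) (central-extend m) ⟩
    central (6 + m) ++ concat rest                          ≡⟨ concat-tail (suc m) j (trans eq (sym (+-suc j (5 + m)))) ⟩
    F n                                                     ∎
  where
  open ≡-Reasoning
  rest : List Str
  rest = reversedFs (5 + m) j ++ [ lastPhrase n ]

greedy-tail : ∀ m j {n} → n ≡ j + (5 + m) →
  AllGreedyFrom (central (5 + m)) (reversedFs (4 + m) j ++ [ lastPhrase n ])
greedy-tail m zero refl = greedy-whole (lastPhrase-in-central m) , tt
greedy-tail m (suc j) {n} eq =
  reverse-F-greedy m (nonEmpty-concat-∷ʳ (reversedFs (5 + m) j) (lastPhrase-nonEmpty n)) ,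
  subst (λ p → AllGreedyFrom p (reversedFs (5 + m) j ++ [ lastPhrase n ])) (sym (central-extend m))
    (greedy-tail (suc m) j (trans eq (sym (+-suc j (5 + m)))))

newSymbol-vs-copy : ∀ {p c r} s → NonEmpty s → IsPrefix (c ∷ []) r → IsPrefix s r →
  ¬ c ∈ p → ¬ IsSubstring s p
newSymbol-vs-copy [] ne _ _ _ _ = ne refl
newSymbol-vs-copy (c′ ∷ s) _ (v , e) (v′ , e′) c∉p (u , w , refl) =
  c∉p (subst (_∈ _) (∷-injectiveˡ (trans (sym e′) e)) (∈-insert u))

greedy-unique : ∀ {p r s₁ s₂} → NonEmpty s₁ → NonEmpty s₂ → IsPrefix s₁ r → IsPrefix s₂ r →
  Greedy p s₁ r → Greedy p s₂ r → s₁ ≡ s₂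
greedy-unique _ _ (v , e) (v′ , e′) (inj₁ (c , refl , _)) (inj₁ (c′ , refl , _)) =
  cong [_] (∷-injectiveˡ (trans (sym e) e′))
greedy-unique _ ne₂ pre₁ pre₂ (inj₁ (c , refl , c∉p)) (inj₂ (_ , occ₂ , _)) =
  ⊥-elim (newSymbol-vs-copy _ ne₂ pre₁ pre₂ c∉p occ₂)
greedy-unique ne₁ _ pre₁ pre₂ (inj₂ (_ , occ₁ , _)) (inj₁ (c , refl , c∉p)) =
  ⊥-elim (newSymbol-vs-copy _ ne₁ pre₂ pre₁ c∉p occ₁)
greedy-unique {s₁ = s₁} {s₂} _ _ (v , e) (v′ , e′) (inj₂ (_ , occ₁ , longest₁)) (inj₂ (_ , occ₂ , longest₂))
  with <-cmp (length s₁) (length s₂)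
... | tri< lt _ _ = ⊥-elim (longest₁ s₂ (v′ , e′) lt occ₂)
... | tri≈ _ eq _ = isPrefix-unique s₁ s₂ v v′ (trans (sym e) e′) eq
... | tri> _ _ gt = ⊥-elim (longest₂ s₁ (v , e) gt occ₁)

allGreedy-unique : ∀ p fs gs → All NonEmpty fs → All NonEmpty gs → concat fs ≡ concat gs →
  AllGreedyFrom p fs → AllGreedyFrom p gs → fs ≡ gs
allGreedy-unique p [] [] _ _ _ _ _ = refl
allGreedy-unique p [] (g ∷ gs) _ (ne ∷ _) eq _ _ = ⊥-elim (ne (++-conicalˡ g _ (sym eq)))
allGreedy-unique p (f ∷ fs) [] (ne ∷ _) _ eq _ _ = ⊥-elim (ne (++-conicalˡ f _ eq))
allGreedy-unique p (f ∷ fs) (g ∷ gs) (nf ∷ nfs) (ng ∷ ngs) eq (gf , gfs) (gg , ggs)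
  with greedy-unique nf ng (concat fs , refl) (concat gs , eq) gf (subst (Greedy p g) (sym eq) gg)
... | refl = cong (f ∷_) (allGreedy-unique (p ++ f) fs gs nfs ngs (++-cancelˡ f _ _ eq) gfs ggs)

isLZ-unique : ∀ {w fs gs} → IsLZ w fs → IsLZ w gs → fs ≡ gs
isLZ-unique ((nfs , cfs) , gfs) ((ngs , cgs) , ggs) = allGreedy-unique [] _ _ nfs ngs (trans cfs (sym cgs)) gfs ggs

aa-notIn-ab : ¬ IsSubstring (a ∷ a ∷ []) (a ∷ b ∷ [])
aa-notIn-ab ([] , _ , ())
aa-notIn-ab (_ ∷ [] , _ , ())
aa-notIn-ab (_ ∷ _ ∷ [] , _ , ())
aa-notIn-ab (_ ∷ _ ∷ _ ∷ _ , _ , ())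

a-greedy-after-ab : ∀ z → Greedy (a ∷ b ∷ []) (a ∷ []) (a ∷ a ∷ z)
a-greedy-after-ab z = inj₂ ((a ∷ z , refl) , ([] , b ∷ [] , refl) , longest)
  where
  longest : ∀ t → IsPrefix t (a ∷ a ∷ z) → length t > 1 → ¬ IsSubstring t (a ∷ b ∷ [])
  longest t pre longer occ with isPrefix-longer (a ∷ []) a z pre longer
  ... | z′ , refl = aa-notIn-ab (isSubstring-prefix (a ∷ a ∷ []) z′ occ)

fibTail : ℕ → List Str
fibTail j = reversedFs 4 j ++ [ lastPhrase (5 + j) ]

fibTail-head : ∀ j → ∃[ z ] concat (fibTail j) ≡ a ∷ z
fibTail-head zero = b ∷ [] , refl
fibTail-head (suc j) = _ , refl

lzFib-fibTail : ∀ j → lzFib (5 + j) ≡ (a ∷ []) ∷ (b ∷ []) ∷ (a ∷ []) ∷ fibTail j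
lzFib-fibTail j = cong (λ fs → (a ∷ []) ∷ (b ∷ []) ∷ (a ∷ []) ∷ (fs ++ [ lastPhrase (5 + j) ]))
  (trans (map-upTo _ j) (applyUpTo-reversedFs 4 j))

isLZ-lzFib : ∀ j → IsLZ (F (5 + j)) (lzFib (5 + j))
isLZ-lzFib j = subst (IsLZ (F (5 + j))) (sym (lzFib-fibTail j)) (
  ((λ ()) ∷ (λ ()) ∷ (λ ()) ∷ ++⁺ (reversedFs-nonEmpty 3 j) (lastPhrase-nonEmpty (5 + j) ∷ []) ,
   concat-tail 0 j (+-comm 5 j)) ,
  inj₁ (a , refl , λ ()) ,
  inj₁ (b , refl , λ { (here ()) ; (there ()) }) ,
  third ,
  greedy-tail 0 j (+-comm 5 j))
  where
  third : Greedy (a ∷ b ∷ []) (a ∷ []) (a ∷ concat (fibTail j))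
  third with fibTail-head j
  ... | z , e = subst (λ r → Greedy (a ∷ b ∷ []) (a ∷ []) (a ∷ r)) (sym e) (a-greedy-after-ab z)

length-lzFib : ∀ j → length (lzFib (5 + j)) ≡ 4 + j
length-lzFib j = cong (3 +_) (begin
    length (map f (upTo j) ++ [ lastPhrase (5 + j) ]) ≡⟨ length-++ (map f (upTo j)) ⟩
    length (map f (upTo j)) + 1                      ≡⟨ cong (_+ 1) (trans (length-map f (upTo j)) (length-upTo j)) ⟩
    j + 1                                            ≡⟨ +-comm j 1 ⟩
    suc j                                            ∎)
  where
  open ≡-Reasoning
  f : ℕ → Str
  f k = reverse (F (4 + k))

lemma2 : (n : ℕ) → 5 ≤ n →
    IsLZ (F n) (lzFib n)
    × (∀ fs → IsLZ (F n) fs → fs ≡ lzFib n)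
    × length (lzFib n) ≡ n ∸ 1
lemma2 (suc (suc (suc (suc (suc j))))) (s≤s (s≤s (s≤s (s≤s (s≤s z≤n))))) =
  isLZ-lzFib j , (λ fs lz → isLZ-unique lz (isLZ-lzFib j)) , length-lzFib j
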